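{- Let $G=(V,E)$ be a directed graph in which every node has at least one out-neighbor, let $\alpha\in(0,1)$, let $v\in V$ be a target node and let $\epsilon>0$. Run the priority queue algorithm (described in the context) for target $v$ with teleport probability $\alpha$, performing pop-and-propagate steps until all priorities are less than $\alpha\epsilon$. Then the resulting score vector $s$ satisfies $|s(u)-\pi(u,v)|<\epsilon$ for all $u\in V$.
   Context: For $u\in V$ let $\mathrm{out}(u)=\{w:(u,w)\in E\}$ and $\mathrm{in}(u)=\{w:(w,u)\in E\}$. (If the original graph has nodes with no out-neighbors, an artificial sink node with a self-loop is added together with an edge from each such node to the sink, so every node has out-degree at least 1.) Personalized PageRank $\pi(u,v)$ is the expected fraction of time spent at $v$ by the following random walk: start at $u$; at each step, with probability $\alpha$ halt, and with probability $1-\alpha$ move to a uniformly random out-neighbor of the current node. Equivalently, $\pi(\cdot,v)$ is the unique solution of $\pi(u,v)=\frac{1-\alpha}{|\mathrm{out}(u)|}\sum_{w\in \mathrm{out}(u)}\pi(w,v)+\alpha\,[u=v]$. The priority queue algorithm maintains for each node $u$ a score $s(u)$ and a priority $p(u)$, both initially $0$ except $s(v)=p(v)=\alpha$, with the nodes kept in a max-priority queue keyed by $p$. A step consists of: take a node $w$ of maximum priority, let $\Delta=p(w)$, set $p(w)=0$, and for each $u\in\mathrm{in}(w)$ increase both $s(u)$ and $p(u)$ by $(1-\alpha)\Delta/|\mathrm{out}(u)|$. The algorithm repeats steps while the maximum priority exceeds $\alpha\epsilon$ and outputs $s$.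
   Formalization: The teleport probability α and the tolerance ε are rational, so the scores, priorities and personalized PageRank values are taken over ℚ. -}

module Defs where

open import Data.Nat as ℕ using (ℕ; zero; suc)
open import Data.Fin using (Fin; zero; suc; _≟_)
open import Data.Bool using (Bool; true; false; if_then_else_)
open import Data.Integer using (+_)
open import Data.Rational using (ℚ; 0ℚ; 1ℚ; _+_; _*_; _-_; _≤_; _/_)
open import Data.Product using (_×_; _,_; ∃)
open import Relation.Nullary using (does)
open import Relation.Binary.PropositionalEquality using (_≡_)

-- A finite directed graph on nodes Fin n: G u w ≡ true iff (u , w) ∈ E.
Graph : ℕ → Set
Graph n = Fin n → Fin n → Bool

AllOutDegPos : ∀ {n} → Graph n → Set
AllOutDegPos {n} G = ∀ (u : Fin n) → ∃ λ w → G u w ≡ true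

sumℚ : ∀ {n} → (Fin n → ℚ) → ℚ
sumℚ {zero}  f = 0ℚ
sumℚ {suc n} f = f zero + sumℚ (λ i → f (suc i))

count : ∀ {n} → (Fin n → Bool) → ℕ
count {zero}  f = zero
count {suc n} f = (if f zero then 1 else 0) ℕ.+ count (λ i → f (suc i))

outdeg : ∀ {n} → Graph n → Fin n → ℕ
outdeg G u = count (G u)

-- 1/k (only used for k = |out(u)| ≥ 1; value at 0 is irrelevant)
inv : ℕ → ℚ
inv zero    = 0ℚ
inv (suc k) = + 1 / suc k

eqᵇ : ∀ {n} → Fin n → Fin n → Bool
eqᵇ x y = does (x ≟ y)

-- π(·,v) : the personalized PageRank vector towards v, characterised as
-- (the unique) solution of
--   π(u,v) = (1-α)/|out(u)| Σ_{w ∈ out(u)} π(w,v) + α [u = v].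
IsPPR : ∀ {n} → Graph n → ℚ → Fin n → (Fin n → ℚ) → Set
IsPPR G α v π = ∀ u →
  π u ≡ ((1ℚ - α) * inv (outdeg G u)) * sumℚ (λ w → if G u w then π w else 0ℚ)
        + (if eqᵇ u v then α else 0ℚ)

-- Algorithm state: (scores s , priorities p)
State : ℕ → Set
State n = (Fin n → ℚ) × (Fin n → ℚ)

initState : ∀ {n} → ℚ → Fin n → State n
initState α v = (λ x → if eqᵇ x v then α else 0ℚ) , (λ x → if eqᵇ x v then α else 0ℚ)

-- One pop-and-propagate step, allowed only while the maximum priority is
-- not yet below αε (the algorithm stops once all priorities are < αε).
-- w has maximum priority, Δ = p w; p(w) := 0; then for every u ∈ in(w)
-- both s(u) and p(u) increase by (1-α)Δ/|out(u)|.
Step : ∀ {n} → Graph n → ℚ → ℚ → State n → State n → Set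
Step {n} G α ε (s , p) (s' , p') = ∃ λ (w : Fin n) →
    (∀ x → p x ≤ p w)
  × (α * ε ≤ p w)
  × (∀ u → s' u ≡ s u + (if G u w then ((1ℚ - α) * p w) * inv (outdeg G u) else 0ℚ))
  × (∀ u → p' u ≡ (if eqᵇ u w then 0ℚ else p u)
                   + (if G u w then ((1ℚ - α) * p w) * inv (outdeg G u) else 0ℚ))

{-# OPTIONS --safe #-}
module Submission where

-- Along any run, the scores and priorities satisfy s = W(s − p) + α·[· = v] and p ≥ 0,
-- where W f u = (1−α)/|out(u)| · Σ_{w ∈ out(u)} f w.  Subtracting this from
-- π = W π + α·[· = v], the error e = π − (s − p) solves e = W e + p.  W is monotone
-- and sends the constant K to (1−α)K, so a maximum principle on the finite node set
-- gives 0 ≤ e, and e < ε once p < αε.  Hence 0 ≤ π − s = W e ≤ e < ε.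

open import Defs
open import Data.Bool using (Bool; true; false; if_then_else_)
open import Data.Fin using (Fin; zero; suc) renaming (_≟_ to _≟ᶠ_)
import Data.Integer as ℤ
import Data.Integer.Tactic.RingSolver as ℤ-Solver
open import Data.Nat using (ℕ; zero; suc)
open import Data.Nat.Coprimality using (1-coprimeTo)
open import Data.Product using (∃; ∃-syntax; _,_; uncurry)
open import Function using (id; _∘_)
open import Data.Rational
open import Data.Rational.Literals using (fromℤ)
open import Data.Rational.Properties
open import Algebra.Properties.AbelianGroup +-0-abelianGroup using (xyx⁻¹≈y)
open import Data.Rational.Solver using (module +-*-Solver)
open +-*-Solver using (solve; _:=_; _:+_; _:-_; _:*_; :-_; con)
open import Data.Rational.Unnormalised as ℚᵘ using (*≡*)
import Data.Rational.Unnormalised.Properties as ℚᵘ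
open import Data.Sum using (inj₁; inj₂)
open import Relation.Binary.Bundles using (TotalPreorder)
import Relation.Binary.Construct.Flip.EqAndOrd as Flip
open import Relation.Binary.Construct.Closure.ReflexiveTransitive using (Star; _◅_) renaming (ε to ε★)
open import Relation.Binary.PropositionalEquality
open import Relation.Nullary using (yes; no)

module _ {a ℓ₁ ℓ₂} (O : TotalPreorder a ℓ₁ ℓ₂) where
  open TotalPreorder O using (Carrier; _≲_; total) renaming (refl to ≲-refl; trans to ≲-trans)

  argmax : ∀ {n} → Fin n → (g : Fin n → Carrier) → ∃[ i ] ∀ j → g j ≲ g i
  argmax {suc zero}    _ g = zero , λ { zero → ≲-refl }
  argmax {suc (suc n)} _ g with argmax zero (λ i → g (suc i))
  ... | i , max with total (g zero) (g (suc i))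
  ... | inj₁ g₀≲gᵢ = suc i , λ { zero → g₀≲gᵢ ; (suc j) → max j }
  ... | inj₂ gᵢ≲g₀ = zero  , λ { zero → ≲-refl ; (suc j) → ≲-trans (max j) gᵢ≲g₀ }

argmaxℚ : ∀ {n} → Fin n → (g : Fin n → ℚ) → ∃[ i ] ∀ j → g j ≤ g i
argmaxℚ = argmax ≤-totalPreorder

argminℚ : ∀ {n} → Fin n → (g : Fin n → ℚ) → ∃[ i ] ∀ j → g i ≤ g j
argminℚ = argmax (Flip.totalPreorder ≤-totalPreorder)

0≤q-p⇒∣p-q∣≡q-p : ∀ p q → 0ℚ ≤ q - p → ∣ p - q ∣ ≡ q - p
0≤q-p⇒∣p-q∣≡q-p p q 0≤q-p = begin
  ∣ p - q ∣       ≡⟨ cong ∣_∣ (p-q≡-[q-p] p q) ⟩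
  ∣ - (q - p) ∣   ≡⟨ ∣-p∣≡∣p∣ (q - p) ⟩
  ∣ q - p ∣       ≡⟨ 0≤p⇒∣p∣≡p 0≤q-p ⟩
  q - p           ∎
  where
  open ≡-Reasoning
  p-q≡-[q-p] : ∀ p q → p - q ≡ - (q - p)
  p-q≡-[q-p] = solve 2 (λ p q → p :- q := :- (q :- p)) refl

1-p-nonNeg : ∀ {p} → p ≤ 1ℚ → NonNegative (1ℚ - p)
1-p-nonNeg {p} p≤1 = nonNegative (subst (_≤ 1ℚ - p) (+-inverseʳ p) (+-monoˡ-≤ (- p) p≤1))

module _ {α : ℚ} (0<α : 0ℚ < α) where
  private
    x-[1-α]x≡αx : ∀ x → x - (1ℚ - α) * x ≡ α * x
    x-[1-α]x≡αx = solve 2 (λ α x → x :- (con 1ℚ :- α) :* x := α :* x) refl α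

    [1-α]x+αc-[1-α]x≡αc : ∀ x c → ((1ℚ - α) * x + α * c) - (1ℚ - α) * x ≡ α * c
    [1-α]x+αc-[1-α]x≡αc x c = xyx⁻¹≈y ((1ℚ - α) * x) (α * c)

  damped-< : ∀ {x c} → x < (1ℚ - α) * x + α * c → x < c
  damped-< {x} {c} x<y = *-cancelˡ-<-nonNeg α {{nonNegative (<⇒≤ 0<α)}}
    (subst₂ _<_ (x-[1-α]x≡αx x) ([1-α]x+αc-[1-α]x≡αc x c) (+-monoˡ-< (- ((1ℚ - α) * x)) x<y))

  damped-≥ : ∀ {x c} → (1ℚ - α) * x + α * c ≤ x → c ≤ x
  damped-≥ {x} {c} y≤x = *-cancelˡ-≤-pos α {{positive 0<α}}
    (subst₂ _≤_ ([1-α]x+αc-[1-α]x≡αc x c) (x-[1-α]x≡αx x) (+-monoˡ-≤ (- ((1ℚ - α) * x)) y≤x))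

sumℚ-cong : ∀ {n} {f g : Fin n → ℚ} → (∀ i → f i ≡ g i) → sumℚ f ≡ sumℚ g
sumℚ-cong {zero}  f≡g = refl
sumℚ-cong {suc n} f≡g = cong₂ _+_ (f≡g zero) (sumℚ-cong (λ i → f≡g (suc i)))

sumℚ-+ : ∀ {n} (f g : Fin n → ℚ) → sumℚ (λ i → f i + g i) ≡ sumℚ f + sumℚ g
sumℚ-+ {zero}  f g = refl
sumℚ-+ {suc n} f g =
  trans (cong ((f zero + g zero) +_) (sumℚ-+ (λ i → f (suc i)) (λ i → g (suc i))))
        (interchange (f zero) (g zero) _ _)
  where
  interchange : ∀ a b c d → (a + b) + (c + d) ≡ (a + c) + (b + d)
  interchange = solve 4 (λ a b c d → (a :+ b) :+ (c :+ d) := (a :+ c) :+ (b :+ d)) refl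

sumℚ-mono : ∀ {n} {f g : Fin n → ℚ} → (∀ i → f i ≤ g i) → sumℚ f ≤ sumℚ g
sumℚ-mono {zero}  f≤g = ≤-refl
sumℚ-mono {suc n} f≤g = +-mono-≤ (f≤g zero) (sumℚ-mono (λ i → f≤g (suc i)))

sumℚ-zero : ∀ {n} → sumℚ {n} (λ _ → 0ℚ) ≡ 0ℚ
sumℚ-zero {zero}  = refl
sumℚ-zero {suc n} = cong (0ℚ +_) (sumℚ-zero {n})

pointMass : ∀ {n} → Fin n → ℚ → Fin n → ℚ
pointMass w a x = if eqᵇ x w then a else 0ℚ

sumℚ-pointMass : ∀ {n} (w : Fin n) (a : ℚ) → sumℚ (pointMass w a) ≡ a
sumℚ-pointMass {suc n} zero    a = trans (cong (a +_) (sumℚ-zero {n})) (+-identityʳ a)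
sumℚ-pointMass {suc n} (suc w) a = trans (cong (0ℚ +_) (sumℚ-pointMass w a)) (+-identityˡ a)

pointMass-nonNeg : ∀ {n} (w : Fin n) {a} → 0ℚ ≤ a → ∀ x → 0ℚ ≤ pointMass w a x
pointMass-nonNeg w 0≤a x with eqᵇ x w
... | true  = 0≤a
... | false = ≤-refl

sumOver : ∀ {n} → (Fin n → Bool) → (Fin n → ℚ) → ℚ
sumOver b f = sumℚ (λ w → if b w then f w else 0ℚ)

sumOver-cong : ∀ {n} (b : Fin n → Bool) {f g : Fin n → ℚ} → (∀ i → f i ≡ g i) → sumOver b f ≡ sumOver b g
sumOver-cong b f≡g = sumℚ-cong (λ i → cong (λ x → if b i then x else 0ℚ) (f≡g i))

sumOver-+ : ∀ {n} (b : Fin n → Bool) (f g : Fin n → ℚ) →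
            sumOver b (λ i → f i + g i) ≡ sumOver b f + sumOver b g
sumOver-+ b f g =
  trans (sumℚ-cong if-distrib) (sumℚ-+ (λ i → if b i then f i else 0ℚ) (λ i → if b i then g i else 0ℚ))
  where
  if-distrib : ∀ i → (if b i then f i + g i else 0ℚ) ≡ (if b i then f i else 0ℚ) + (if b i then g i else 0ℚ)
  if-distrib i with b i
  ... | true  = refl
  ... | false = refl

sumOver-mono : ∀ {n} (b : Fin n → Bool) {f g : Fin n → ℚ} → (∀ i → f i ≤ g i) → sumOver b f ≤ sumOver b g
sumOver-mono b {f} {g} f≤g = sumℚ-mono if-mono
  where
  if-mono : ∀ i → (if b i then f i else 0ℚ) ≤ (if b i then g i else 0ℚ)
  if-mono i with b i
  ... | true  = f≤g i
  ... | false = ≤-refl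

sumOver-pointMass : ∀ {n} (b : Fin n → Bool) (w : Fin n) (a : ℚ) →
                    sumOver b (pointMass w a) ≡ (if b w then a else 0ℚ)
sumOver-pointMass b w a = trans (sumℚ-cong restrict) (sumℚ-pointMass w _)
  where
  restrict : ∀ i → (if b i then pointMass w a i else 0ℚ) ≡ pointMass w (if b w then a else 0ℚ) i
  restrict i with i ≟ᶠ w
  ... | yes refl = refl
  ... | no _ with b i
  ...   | true  = refl
  ...   | false = refl

fromℤ-suc : ∀ m → fromℤ (ℤ.+ suc m) ≡ 1ℚ + fromℤ (ℤ.+ m)
fromℤ-suc m = toℚᵘ-injective (ℚᵘ.≃-sym (ℚᵘ.≃-trans (toℚᵘ-homo-+ 1ℚ (fromℤ (ℤ.+ m))) (*≡* (cross (ℤ.+ m)))))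
  where
  cross : ∀ x → (ℤ.+ 1 ℤ.* ℤ.+ 1 ℤ.+ x ℤ.* ℤ.+ 1) ℤ.* ℤ.+ 1 ≡ (ℤ.+ 1 ℤ.+ x) ℤ.* (ℤ.+ 1 ℤ.* ℤ.+ 1)
  cross = ℤ-Solver.solve-∀

sumOver-const : ∀ {n} (b : Fin n → Bool) (K : ℚ) → sumOver b (λ _ → K) ≡ K * fromℤ (ℤ.+ count b)
sumOver-const {zero}  b K = sym (*-zeroʳ K)
sumOver-const {suc n} b K with b zero | sumOver-const (λ i → b (suc i)) K
... | true  | ih = begin
  K + sumOver (λ i → b (suc i)) (λ _ → K)  ≡⟨ cong (K +_) ih ⟩
  K + K * fromℤ (ℤ.+ m)                    ≡⟨ distrib K (fromℤ (ℤ.+ m)) ⟩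
  K * (1ℚ + fromℤ (ℤ.+ m))                 ≡⟨ cong (K *_) (fromℤ-suc m) ⟨
  K * fromℤ (ℤ.+ suc m)                    ∎
  where
  open ≡-Reasoning
  m = count (λ i → b (suc i))
  distrib : ∀ K x → K + K * x ≡ K * (1ℚ + x)
  distrib = solve 2 (λ K x → K :+ K :* x := K :* (con 1ℚ :+ x)) refl
... | false | ih = trans (+-identityˡ _) ih

-- inv (suc k) normalises 1/(k+1), which is already in lowest terms, i.e. literally 1/ (k+1).
inv-suc-inverse : ∀ k → inv (suc k) * fromℤ (ℤ.+ suc k) ≡ 1ℚ
inv-suc-inverse k = trans (cong (_* q) (normalize-coprime (1-coprimeTo (suc k)))) (*-inverseˡ q)
  where
  q = fromℤ (ℤ.+ suc k)

count-suc : ∀ {n} (b : Fin n → Bool) {w} → b w ≡ true → ∃[ k ] count b ≡ suc k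
count-suc {suc n} b {zero}  b₀ rewrite b₀ = count (λ i → b (suc i)) , refl
count-suc {suc n} b {suc w} bw with count-suc (λ i → b (suc i)) bw | b zero
... | k , eq | true  = suc k , cong suc eq
... | k , eq | false = k , eq

inv-count-inverse : ∀ {n} (b : Fin n → Bool) {w} → b w ≡ true → inv (count b) * fromℤ (ℤ.+ count b) ≡ 1ℚ
inv-count-inverse b bw with count-suc b bw
... | k , eq rewrite eq = inv-suc-inverse k

inv-nonNeg : ∀ k → NonNegative (inv k)
inv-nonNeg zero    = _
inv-nonNeg (suc k) = normalize-nonNeg 1 (suc k)

module RandomWalk {n : ℕ} (G : Graph n) (α : ℚ) where

  weight : Fin n → ℚ
  weight u = (1ℚ - α) * inv (outdeg G u)

  weight-nonNeg : α ≤ 1ℚ → ∀ u → NonNegative (weight u)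
  weight-nonNeg α≤1 u =
    nonNeg*nonNeg⇒nonNeg (1ℚ - α) {{1-p-nonNeg α≤1}} (inv (outdeg G u)) {{inv-nonNeg (outdeg G u)}}

  walk : (Fin n → ℚ) → Fin n → ℚ
  walk f u = weight u * sumOver (G u) f

  walk-cong : ∀ {f g} → (∀ x → f x ≡ g x) → ∀ u → walk f u ≡ walk g u
  walk-cong f≡g u = cong (weight u *_) (sumOver-cong (G u) f≡g)

  walk-+ : ∀ f g u → walk (λ x → f x + g x) u ≡ walk f u + walk g u
  walk-+ f g u = trans (cong (weight u *_) (sumOver-+ (G u) f g)) (*-distribˡ-+ (weight u) _ _)

  walk-pointMass : ∀ w a u →
    walk (pointMass w a) u ≡ (if G u w then ((1ℚ - α) * a) * inv (outdeg G u) else 0ℚ)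
  walk-pointMass w a u with G u w | sumOver-pointMass (G u) w a
  ... | true  | sum≡a = trans (cong (weight u *_) sum≡a) (reorder (1ℚ - α) _ a)
    where
    reorder : ∀ x y a → (x * y) * a ≡ (x * a) * y
    reorder = solve 3 (λ x y a → (x :* y) :* a := (x :* a) :* y) refl
  ... | false | sum≡0 = trans (cong (weight u *_) sum≡0) (*-zeroʳ (weight u))

  walk-mono : α ≤ 1ℚ → ∀ {f g} → (∀ x → f x ≤ g x) → ∀ u → walk f u ≤ walk g u
  walk-mono α≤1 f≤g u =
    *-monoˡ-≤-nonNeg (weight u) {{weight-nonNeg α≤1 u}} (sumOver-mono (G u) f≤g)

  walk-const : AllOutDegPos G → ∀ K u → walk (λ _ → K) u ≡ (1ℚ - α) * K
  walk-const outdeg>0 K u with outdeg>0 u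
  ... | w , Guw = begin
    ((1ℚ - α) * inv d) * sumOver (G u) (λ _ → K)  ≡⟨ cong (weight u *_) (sumOver-const (G u) K) ⟩
    ((1ℚ - α) * inv d) * (K * fromℤ (ℤ.+ d))      ≡⟨ reorder (1ℚ - α) (inv d) K (fromℤ (ℤ.+ d)) ⟩
    ((1ℚ - α) * K) * (inv d * fromℤ (ℤ.+ d))      ≡⟨ cong (((1ℚ - α) * K) *_) (inv-count-inverse (G u) Guw) ⟩
    ((1ℚ - α) * K) * 1ℚ                           ≡⟨ *-identityʳ ((1ℚ - α) * K) ⟩
    (1ℚ - α) * K                                  ∎
    where
    open ≡-Reasoning
    d = outdeg G u
    reorder : ∀ x y K z → (x * y) * (K * z) ≡ (x * K) * (y * z)
    reorder = solve 4 (λ x y K z → (x :* y) :* (K :* z) := (x :* K) :* (y :* z)) refl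

  module _ (outdeg>0 : AllOutDegPos G) (α≤1 : α ≤ 1ℚ) where

    walk-≤ : ∀ {f c} → (∀ x → f x ≤ c) → ∀ u → walk f u ≤ (1ℚ - α) * c
    walk-≤ {f} {c} f≤c u = subst (walk f u ≤_) (walk-const outdeg>0 c u) (walk-mono α≤1 f≤c u)

    walk-≥ : ∀ {f c} → (∀ x → c ≤ f x) → ∀ u → (1ℚ - α) * c ≤ walk f u
    walk-≥ {f} {c} c≤f u = subst (_≤ walk f u) (walk-const outdeg>0 c u) (walk-mono α≤1 c≤f u)

    walk-nonNeg : ∀ {f} → (∀ x → 0ℚ ≤ f x) → ∀ u → 0ℚ ≤ walk f u
    walk-nonNeg {f} 0≤f u = subst (_≤ walk f u) (*-zeroʳ (1ℚ - α)) (walk-≥ 0≤f u)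

    module _ (0<α : 0ℚ < α) {f p : Fin n → ℚ} (fixpoint : ∀ x → f x ≡ walk f x + p x) where
      open ≤-Reasoning

      walk-fixpoint-< : ∀ {c} → (∀ x → p x < α * c) → ∀ x → f x < c
      walk-fixpoint-< {c} p<αc x with argmaxℚ x f
      ... | i , f≤fᵢ = ≤-<-trans (f≤fᵢ x) (damped-< 0<α (begin-strict
        f i                     ≡⟨ fixpoint i ⟩
        walk f i + p i          <⟨ +-mono-≤-< (walk-≤ f≤fᵢ i) (p<αc i) ⟩
        (1ℚ - α) * f i + α * c  ∎))

      walk-fixpoint-≥ : ∀ {c} → (∀ x → α * c ≤ p x) → ∀ x → c ≤ f x
      walk-fixpoint-≥ {c} αc≤p x with argminℚ x f
      ... | j , fⱼ≤f = ≤-trans (damped-≥ 0<α (begin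
        (1ℚ - α) * f j + α * c  ≤⟨ +-mono-≤ (walk-≥ fⱼ≤f j) (αc≤p j) ⟩
        walk f j + p j          ≡⟨ fixpoint j ⟨
        f j                     ∎)) (fⱼ≤f x)

module PriorityQueue {n : ℕ} (G : Graph n) (outdeg>0 : AllOutDegPos G)
                     (α : ℚ) (0<α : 0ℚ < α) (α≤1 : α ≤ 1ℚ) (v : Fin n) where
  open RandomWalk G α

  record Invariant (s p : Fin n → ℚ) : Set where
    field
      score-eq        : ∀ u → s u ≡ walk (λ w → s w - p w) u + pointMass v α u
      priority-nonNeg : ∀ u → 0ℚ ≤ p u

  init-invariant : Invariant (pointMass v α) (pointMass v α)
  init-invariant = record
    { score-eq        = λ u → sym (trans (cong (_+ pointMass v α u) (walk-zero u)) (+-identityˡ _))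
    ; priority-nonNeg = pointMass-nonNeg v (<⇒≤ 0<α)
    }
    where
    walk-zero : ∀ u → walk (λ w → pointMass v α w - pointMass v α w) u ≡ 0ℚ
    walk-zero u = begin
      walk (λ w → pointMass v α w - pointMass v α w) u  ≡⟨ walk-cong (λ w → +-inverseʳ (pointMass v α w)) u ⟩
      walk (λ _ → 0ℚ) u                                  ≡⟨ walk-const outdeg>0 0ℚ u ⟩
      (1ℚ - α) * 0ℚ                                      ≡⟨ *-zeroʳ (1ℚ - α) ⟩
      0ℚ                                                 ∎
      where open ≡-Reasoning

  step-invariant : ∀ {ε σ τ} → Step G α ε σ τ → uncurry Invariant σ → uncurry Invariant τ
  step-invariant {σ = s , p} {τ = s′ , p′} (w , _ , _ , s′-eq , p′-eq) I = record
    { score-eq        = score-eq′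
    ; priority-nonNeg = priority-nonNeg′
    }
    where
    open Invariant I
    open ≡-Reasoning

    popped : Fin n → ℚ
    popped x = if eqᵇ x w then 0ℚ else p x

    increment : Fin n → ℚ
    increment x = if G x w then ((1ℚ - α) * p w) * inv (outdeg G x) else 0ℚ

    residual′ : ∀ x → s′ x - p′ x ≡ (s x - p x) + pointMass w (p w) x
    residual′ x = trans (cong₂ _-_ (s′-eq x) (p′-eq x)) (pop-w x)
      where
      pop-w : ∀ x → (s x + increment x) - (popped x + increment x) ≡ (s x - p x) + pointMass w (p w) x
      pop-w x with x ≟ᶠ w
      ... | yes refl = pop (s x) (p x) (increment x)
        where
        pop : ∀ s p t → (s + t) - (0ℚ + t) ≡ (s - p) + p
        pop = solve 3 (λ s p t → (s :+ t) :- (con 0ℚ :+ t) := (s :- p) :+ p) refl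
      ... | no _ = keep (s x) (p x) (increment x)
        where
        keep : ∀ s p t → (s + t) - (p + t) ≡ (s - p) + 0ℚ
        keep = solve 3 (λ s p t → (s :+ t) :- (p :+ t) := (s :- p) :+ con 0ℚ) refl

    score-eq′ : ∀ u → s′ u ≡ walk (λ x → s′ x - p′ x) u + pointMass v α u
    score-eq′ u = begin
      s′ u                                          ≡⟨ s′-eq u ⟩
      s u + increment u                             ≡⟨ cong₂ _+_ (score-eq u) (sym (walk-pointMass w (p w) u)) ⟩
      (walk r u + δ) + walk pushed u                ≡⟨ swap (walk r u) δ (walk pushed u) ⟩
      (walk r u + walk pushed u) + δ                ≡⟨ cong (_+ δ) (walk-+ r pushed u) ⟨
      walk (λ x → r x + pushed x) u + δ             ≡⟨ cong (_+ δ) (walk-cong residual′ u) ⟨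
      walk (λ x → s′ x - p′ x) u + δ                ∎
      where
      r = λ x → s x - p x
      pushed = pointMass w (p w)
      δ = pointMass v α u
      swap : ∀ a b c → (a + b) + c ≡ (a + c) + b
      swap = solve 3 (λ a b c → (a :+ b) :+ c := (a :+ c) :+ b) refl

    priority-nonNeg′ : ∀ u → 0ℚ ≤ p′ u
    priority-nonNeg′ u = subst (0ℚ ≤_) (sym (p′-eq u))
      (subst (0ℚ ≤_) (cong (popped u +_) (walk-pointMass w (p w) u))
        (+-mono-≤ popped-nonNeg (walk-nonNeg outdeg>0 α≤1 (pointMass-nonNeg w (priority-nonNeg w)) u)))
      where
      popped-nonNeg : 0ℚ ≤ popped u
      popped-nonNeg with eqᵇ u w
      ... | true  = ≤-refl
      ... | false = priority-nonNeg u

  run-invariant : ∀ {ε σ τ} → Star (Step G α ε) σ τ → uncurry Invariant σ → uncurry Invariant τ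
  run-invariant ε★             = id
  run-invariant (step ◅ steps) = run-invariant steps ∘ step-invariant step

  error : (π s p : Fin n → ℚ) → Fin n → ℚ
  error π s p x = π x - (s x - p x)

  error-fixpoint : ∀ {π s p} → IsPPR G α v π → Invariant s p →
                   ∀ x → error π s p x ≡ walk (error π s p) x + p x
  error-fixpoint {π} {s} {p} ppr I x = begin
    π x - r x                                                ≡⟨ cong₂ (λ a b → a - (b - p x)) (ppr x) (score-eq x) ⟩
    (walk π x + δ) - ((walk r x + δ) - p x)                  ≡⟨ cong (λ a → (a + δ) - ((walk r x + δ) - p x)) walk-π ⟩
    ((walk e x + walk r x) + δ) - ((walk r x + δ) - p x)     ≡⟨ cancel (walk e x) (walk r x) δ (p x) ⟩
    walk e x + p x                                           ∎
    where
    open Invariant I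
    open ≡-Reasoning
    r e : Fin n → ℚ
    r y = s y - p y
    e = error π s p
    δ = pointMass v α x
    walk-π : walk π x ≡ walk e x + walk r x
    walk-π = trans (walk-cong (λ y → sym (minus-plus (π y) (r y))) x) (walk-+ e r x)
      where
      minus-plus : ∀ a b → (a - b) + b ≡ a
      minus-plus = solve 2 (λ a b → (a :- b) :+ b := a) refl
    cancel : ∀ a b c d → ((a + b) + c) - ((b + c) - d) ≡ a + d
    cancel = solve 4 (λ a b c d → ((a :+ b) :+ c) :- ((b :+ c) :- d) := a :+ d) refl

  approximation : ∀ {π} → IsPPR G α v π → ∀ {s p ε} → Invariant s p → (∀ x → p x < α * ε) →
                  ∀ u → ∣ s u - π u ∣ < ε
  approximation {π} ppr {s} {p} {ε} I p<αε u =
    subst (_< ε) (sym (0≤q-p⇒∣p-q∣≡q-p (s u) (π u) 0≤π-s)) π-s<ε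
    where
    open Invariant I
    e = error π s p
    e-fixpoint = error-fixpoint ppr I

    e-nonNeg : ∀ x → 0ℚ ≤ e x
    e-nonNeg = walk-fixpoint-≥ outdeg>0 α≤1 0<α e-fixpoint
                 (λ x → subst (_≤ p x) (sym (*-zeroʳ α)) (priority-nonNeg x))

    π-s≡walk-e : π u - s u ≡ walk e u
    π-s≡walk-e = begin
      π u - s u                ≡⟨ shift (π u) (s u) (p u) ⟩
      e u - p u                ≡⟨ cong (_- p u) (e-fixpoint u) ⟩
      (walk e u + p u) - p u   ≡⟨ plus-minus (walk e u) (p u) ⟩
      walk e u                 ∎
      where
      open ≡-Reasoning
      shift : ∀ a b c → a - b ≡ (a - (b - c)) - c
      shift = solve 3 (λ a b c → a :- b := (a :- (b :- c)) :- c) refl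
      plus-minus : ∀ a b → (a + b) - b ≡ a
      plus-minus = solve 2 (λ a b → (a :+ b) :- b := a) refl

    0≤π-s : 0ℚ ≤ π u - s u
    0≤π-s = subst (0ℚ ≤_) (sym π-s≡walk-e) (walk-nonNeg outdeg>0 α≤1 e-nonNeg u)

    π-s<ε : π u - s u < ε
    π-s<ε = begin-strict
      π u - s u       ≡⟨ π-s≡walk-e ⟩
      walk e u        ≡⟨ +-identityʳ (walk e u) ⟨
      walk e u + 0ℚ   ≤⟨ +-monoʳ-≤ (walk e u) (priority-nonNeg u) ⟩
      walk e u + p u  ≡⟨ e-fixpoint u ⟨
      e u             <⟨ walk-fixpoint-< outdeg>0 α≤1 0<α e-fixpoint p<αε u ⟩
      ε               ∎
      where open ≤-Reasoning

theorem1 : (n : ℕ) (G : Graph n) → AllOutDegPos G →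
    (α : ℚ) → 0ℚ < α → α < 1ℚ → (v : Fin n) → (ε : ℚ) → 0ℚ < ε →
    (π : Fin n → ℚ) → IsPPR G α v π →
    (s p : Fin n → ℚ) → Star (Step G α ε) (initState α v) (s , p) →
    (∀ x → p x < α * ε) →
    ∀ u → ∣ s u - π u ∣ < ε
theorem1 n G outdeg>0 α 0<α α<1 v ε _ π ppr s p run p<αε =
  approximation ppr (run-invariant run init-invariant) p<αε
  where
  open PriorityQueue G outdeg>0 α 0<α (<⇒≤ α<1) v
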